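{- The sequence $\mathcal D_k^1:=L_\infty(p_{k+1})-L_\infty(p_k)$, $k\ge1$, takes arbitrarily large values, but $\mathcal D_k^1\ne 3$ and $\mathcal D_k^1\neq 5$ for every $k\ge 1$.
   Context: $p_1<p_2<\cdots$ denote the prime numbers in increasing order ($p_1=2$). For a positive integer $K=\prod_k p_k^{i_k}$ let $\|K\|_\infty=\max_k i_k$ be its largest prime exponent, with $\|1\|_\infty=0$. Define $L_\infty(1)=0$ and for $N\ge2$, $L_\infty(N)=\sum_{K=1}^{N-1}\max\{\|K+1\|_\infty,\|K\|_\infty\}$. -}

module Defs where

open import Data.Nat using (ℕ; zero; suc; _+_; _∸_; _⊔_; _≤?_; _!)
open import Data.Nat.Divisibility using (_∣?_)
open import Data.Nat.DivMod using (_/_)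
open import Data.Nat.Primality using (prime?)
open import Data.List using (List; map; foldr; filter; upTo)
open import Data.Nat.ListAction using (sum)
open import Relation.Nullary.Decidable using (Dec; yes; no)

-- multiplicity (p-adic valuation) of d in K, computed with fuel;
-- for K ≥ 1, d ≥ 2 and fuel ≥ K this is the exact largest i with d^i ∣ K.
mult : ℕ → ℕ → ℕ → ℕ
mult zero d K = 0
mult (suc f) zero K = 0
mult (suc f) (suc zero) K = 0
mult (suc f) (suc (suc q)) K with suc (suc q) ∣? K
... | yes _ = suc (mult f (suc (suc q)) (K / suc (suc q)))
... | no _ = 0

-- ‖K‖∞ : the largest exponent in the prime factorisation of K (‖1‖∞ = 0)
maxExp : ℕ → ℕ
maxExp K = foldr _⊔_ 0 (map (λ d → mult K d K) (filter prime? (upTo (suc K))))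

-- L∞(N) = Σ_{K=1}^{N-1} max{‖K+1‖∞, ‖K‖∞};  L∞(1) = 0 (empty sum); L∞(0) := 0 (junk)
L∞ : ℕ → ℕ
L∞ zero = 0
L∞ (suc n) = sum (map (λ j → maxExp (suc (suc j)) ⊔ maxExp (suc j)) (upTo n))

-- first prime among m, m+1, ..., m+f-1 (returns m+f if none, never used)
findPrime : ℕ → ℕ → ℕ
findPrime zero m = m
findPrime (suc f) m with prime? m
... | yes _ = m
... | no _ = findPrime f (suc m)

-- the least prime > n (by Euclid there is one in (n, n!+1], so fuel n! suffices)
nextPrime : ℕ → ℕ
nextPrime n = findPrime (n !) (suc n)

-- p k = k-th prime for k ≥ 1 (p 1 = 2); p 0 = 1 is a junk value, never used
p : ℕ → ℕ
p zero = 1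
p (suc k) = nextPrime (p k)

-- 𝒟¹_k = L∞(p_{k+1}) − L∞(p_k)   (L∞ is nondecreasing, so truncated ∸ is exact)
D¹ : ℕ → ℕ
D¹ k = L∞ (p (suc k)) ∸ L∞ (p k)

{-# OPTIONS --safe #-}
-- D¹ k is the sum of μ K = max{‖K+1‖∞, ‖K‖∞} over the prime gap p k ≤ K < p (k+1).
-- The gap containing 2^(B+1) has a term ≥ B + 1, so D¹ is unbounded.  For k ≥ 2
-- the gap starts at an odd prime q and has even length.  If it is 2, then
-- ‖q‖∞ = ‖q+2‖∞ = 1 ≤ ‖q+1‖∞ and D¹ k = 2‖q+1‖∞ is even.  Otherwise one of
-- q+1, q+3 is divisible by 4, so among the first four terms, all ≥ 1, two are ≥ 2,
-- and D¹ k ≥ 6.  Finally D¹ 1 = 1.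
module Submission where

open import Defs
open import Data.Nat
open import Data.Nat.Properties
open import Data.Nat.Divisibility
open import Data.Nat.DivMod using (_/_; n/n≡1; m*n/n≡m)
open import Data.Nat.Primality
  using (Prime; prime?; prime[2]; prime⇒irreducible; prime⇒nonZero; prime⇒nonTrivial)
open import Data.Nat.Primality.Factorisation using (factorise)
open import Data.Nat.ListAction using (sum; product)
open import Data.Nat.ListAction.Properties using (sum-++)
open import Data.List using ([]; _∷_; map; filter; upTo; _∷ʳ_)
open import Data.List.Properties using (upTo-∷ʳ; map-++; foldr-preservesᵇ; foldr-preservesᵒ)
open import Data.List.Relation.Unary.All as All using (_∷_)
open import Data.List.Membership.Propositional using (_∈_; lose)
open import Data.List.Membership.Propositional.Properties
  using (∈-map⁺; ∈-map⁻; ∈-filter⁺; ∈-filter⁻; ∈-upTo⁺; ∈-upTo⁻)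
open import Data.Product using (_×_; _,_; ∃-syntax)
open import Data.Sum using (_⊎_; inj₁; inj₂; [_,_]′)
open import Function using (_∘_)
open import Relation.Nullary using (yes; no; contradiction)
open import Relation.Nullary.Decidable using (from-no)
open import Relation.Binary.PropositionalEquality

prime⇒2≤ : ∀ {q} → Prime q → 2 ≤ q
prime⇒2≤ {q} pq = nonTrivial⇒n>1 q {{prime⇒nonTrivial pq}}

∃-prime-∣ : ∀ {n} → 2 ≤ n → ∃[ q ] (Prime q × q ∣ n)
∃-prime-∣ {n@(suc _)} 2≤n with factorise n
... | record { factors = [] ; isFactorisation = n≡1 } = contradiction (sym n≡1) (<⇒≢ 2≤n)
... | record { factors = q ∷ qs ; isFactorisation = n≡q*qs ; factorsPrime = pq ∷ _ } =
  q , pq , subst (q ∣_) (sym n≡q*qs) (m∣m*n (product qs))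

∣n! : ∀ {d n} → .{{NonZero d}} → d ≤ n → d ∣ n !
∣n! {suc d} d≤n = ∣-trans (m∣m*n (d !)) (m≤n⇒m!∣n! d≤n)

∃-prime-between : ∀ n → ∃[ q ] (Prime q × n < q × q ≤ suc (n !))
∃-prime-between n with q , pq , q∣n!+1 ← ∃-prime-∣ (s≤s (1≤n! n)) = q , pq , n<q , ∣⇒≤ q∣n!+1
  where
  instance _ = prime⇒nonZero pq
  n<q : n < q
  n<q = ≰⇒> λ q≤n →
    let q∣1 = ∣m+n∣m⇒∣n (subst (q ∣_) (+-comm 1 (n !)) q∣n!+1) (∣n! q≤n)
    in <⇒≢ (prime⇒2≤ pq) (sym (∣1⇒≡1 q∣1))

findPrime-≥ : ∀ f m → m ≤ findPrime f m
findPrime-≥ zero m = ≤-refl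
findPrime-≥ (suc f) m with prime? m
... | yes _ = ≤-refl
... | no _ = ≤-trans (n≤1+n m) (findPrime-≥ f (suc m))

findPrime-prime : ∀ f m {q} → Prime q → m ≤ q → q < m + f → Prime (findPrime f m)
findPrime-prime zero m {q} _ m≤q q<m+0 = contradiction m≤q (<⇒≱ (subst (q <_) (+-identityʳ m) q<m+0))
findPrime-prime (suc f) m {q} pq m≤q q<m+f with prime? m
... | yes pm = pm
... | no ¬pm with m≤n⇒m<n∨m≡n m≤q
...   | inj₂ refl = contradiction pq ¬pm
...   | inj₁ m<q = findPrime-prime f (suc m) pq m<q (subst (q <_) (+-suc m f) q<m+f)

nextPrime-prime : ∀ {n} → 1 ≤ n → Prime (nextPrime n)
nextPrime-prime {n} 1≤n with q , pq , n<q , q≤n!+1 ← ∃-prime-between n =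
  findPrime-prime (n !) (suc n) pq n<q (s≤s (≤-trans q≤n!+1 (+-monoˡ-≤ (n !) 1≤n)))

p<p-suc : ∀ k → p k < p (suc k)
p<p-suc k = findPrime-≥ (p k !) (suc (p k))

k<p : ∀ k → k < p k
k<p zero = ≤-refl
k<p (suc k) = ≤-trans (s≤s (k<p k)) (p<p-suc k)

p≥1 : ∀ k → 1 ≤ p k
p≥1 k = ≤-trans (s≤s z≤n) (k<p k)

p-prime : ∀ {k} → 1 ≤ k → Prime (p k)
p-prime {suc k} _ = nextPrime-prime (p≥1 k)

∃-primeGap∋ : ∀ {N} → 2 ≤ N → ∃[ k ] (1 ≤ k × p k ≤ N × N < p (suc k))
∃-primeGap∋ {N} 2≤N = search N (≤-trans (n≤1+n _) (k<p (suc N)))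
  where
  search : ∀ m → N < p (suc m) → ∃[ k ] (1 ≤ k × p k ≤ N × N < p (suc k))
  search zero N<p1 = contradiction 2≤N (<⇒≱ N<p1)
  search (suc m) N<p[m+2] with p (suc m) ≤? N
  ... | yes p[m+1]≤N = suc m , s≤s z≤n , p[m+1]≤N , N<p[m+2]
  ... | no p[m+1]≰N = search m (≰⇒> p[m+1]≰N)

n<d^n : ∀ {d} → 1 < d → ∀ n → n < d ^ n
n<d^n 1<d zero = s≤s z≤n
n<d^n {d} 1<d (suc n) = ≤-<-trans (n<d^n 1<d n) (^-monoʳ-< d 1<d (n<1+n n))

maxExp-lub : ∀ {c} K → (∀ {d} → Prime d → d ≤ K → mult K d K ≤ c) → maxExp K ≤ c
maxExp-lub {c} K bound = foldr-preservesᵇ {P = _≤ c} {f = _⊔_} ⊔-lub z≤n (All.tabulate bounded)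
  where
  bounded : ∀ {x} → x ∈ map (λ d → mult K d K) (filter prime? (upTo (suc K))) → x ≤ c
  bounded x∈ with d , d∈ , refl ← ∈-map⁻ (λ d → mult K d K) x∈
             with d∈upTo , pd ← ∈-filter⁻ prime? d∈ = bound pd (≤-pred (∈-upTo⁻ d∈upTo))

mult≤maxExp : ∀ {d K} → Prime d → d ≤ K → mult K d K ≤ maxExp K
mult≤maxExp {d} {K} pd d≤K =
  foldr-preservesᵒ {P = mult K d K ≤_} {f = _⊔_}
    (λ x y → [ (λ h → ≤-trans h (m≤m⊔n x y)) , (λ h → ≤-trans h (m≤n⊔m x y)) ]′) 0 _
    (inj₂ (lose (∈-map⁺ (λ d → mult K d K) (∈-filter⁺ prime? (∈-upTo⁺ (s≤s d≤K)) pd)) ≤-refl))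

mult-∣ : ∀ f q {K} → 2+ q ∣ K → mult (suc f) (2+ q) K ≡ suc (mult f (2+ q) (K / 2+ q))
mult-∣ f q {K} d∣K with 2+ q ∣? K
... | yes _ = refl
... | no d∤K = contradiction d∣K d∤K

mult-∤ : ∀ f d {K} → d ∤ K → mult f d K ≡ 0
mult-∤ zero d _ = refl
mult-∤ (suc f) zero _ = refl
mult-∤ (suc f) (suc zero) _ = refl
mult-∤ (suc f) (2+ q) {K} d∤K with 2+ q ∣? K
... | yes d∣K = contradiction d∣K d∤K
... | no _ = refl

≤mult-^* : ∀ {d} e f c → 2 ≤ d → e ≤ f → e ≤ mult f d (d ^ e * c)
≤mult-^* zero f c _ _ = z≤n
≤mult-^* {d@(2+ q)} (suc e) (suc f) c 2≤d@(s≤s (s≤s _)) (s≤s e≤f) = begin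
  suc e                               ≤⟨ s≤s (≤mult-^* e f c 2≤d e≤f) ⟩
  suc (mult f d (d ^ e * c))          ≡⟨ cong (suc ∘ mult f d) d^[e+1]c/d≡d^ec ⟨
  suc (mult f d (d ^ suc e * c / d))  ≡⟨ mult-∣ f q (∣m⇒∣m*n c (m∣m*n (d ^ e))) ⟨
  mult (suc f) d (d ^ suc e * c)      ∎
  where
  open ≤-Reasoning
  d^[e+1]c/d≡d^ec : d ^ suc e * c / d ≡ d ^ e * c
  d^[e+1]c/d≡d^ec = begin-equality
    d * d ^ e * c / d    ≡⟨ cong (_/ d) (trans (*-assoc d (d ^ e) c) (*-comm d (d ^ e * c))) ⟩
    d ^ e * c * d / d    ≡⟨ m*n/n≡m (d ^ e * c) d ⟩
    d ^ e * c            ∎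

^∣⇒≤maxExp : ∀ {d e K} → .{{NonZero K}} → Prime d → d ^ e ∣ K → e ≤ maxExp K
^∣⇒≤maxExp {e = zero} _ _ = z≤n
^∣⇒≤maxExp {d} {suc e} {K} pd dᵉ∣K@(divides c K≡c*dᵉ) = begin
  suc e                    ≤⟨ ≤mult-^* (suc e) K c 2≤d e≤K ⟩
  mult K d (d ^ suc e * c) ≡⟨ cong (mult K d) (trans (*-comm (d ^ suc e) c) (sym K≡c*dᵉ)) ⟩
  mult K d K               ≤⟨ mult≤maxExp pd d≤K ⟩
  maxExp K                 ∎
  where
  open ≤-Reasoning
  instance _ = prime⇒nonZero pd
  2≤d : 2 ≤ d
  2≤d = prime⇒2≤ pd
  dᵉ≤K : d ^ suc e ≤ K
  dᵉ≤K = ∣⇒≤ dᵉ∣K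
  e≤K : suc e ≤ K
  e≤K = <⇒≤ (<-≤-trans (n<d^n 2≤d (suc e)) dᵉ≤K)
  d≤K : d ≤ K
  d≤K = ≤-trans (m≤m*n d (d ^ e) {{m^n≢0 d e}}) dᵉ≤K

1≤maxExp : ∀ {K} → 2 ≤ K → 1 ≤ maxExp K
1≤maxExp {K@(suc _)} 2≤K with q , pq , q∣K ← ∃-prime-∣ 2≤K =
  ^∣⇒≤maxExp pq (subst (_∣ K) (sym (*-identityʳ q)) q∣K)

mult-self : ∀ {d} → 2 ≤ d → mult d d d ≡ 1
mult-self {d@(2+ q)} (s≤s (s≤s _)) = begin
  mult d d d                  ≡⟨ mult-∣ (suc q) q ∣-refl ⟩
  suc (mult (suc q) d (d / d)) ≡⟨ cong (suc ∘ mult (suc q) d) (n/n≡1 d) ⟩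
  suc (mult (suc q) d 1)      ≡⟨ cong suc (mult-∤ (suc q) d (>⇒∤ (s≤s (s≤s z≤n)))) ⟩
  1                           ∎
  where open ≡-Reasoning

maxExp≤1 : ∀ {q} → Prime q → maxExp q ≤ 1
maxExp≤1 {q} pq = maxExp-lub q bound
  where
  bound : ∀ {d} → Prime d → d ≤ q → mult q d q ≤ 1
  bound {d} pd _ with d ∣? q
  ... | no d∤q = ≤-trans (≤-reflexive (mult-∤ q d d∤q)) z≤n
  ... | yes d∣q with prime⇒irreducible pq d∣q
  ...   | inj₁ refl = contradiction (prime⇒2≤ pd) (<-irrefl refl)
  ...   | inj₂ refl = ≤-reflexive (mult-self (prime⇒2≤ pq))

μ : ℕ → ℕ
μ K = maxExp (suc K) ⊔ maxExp K

μ-sum : ℕ → ℕ → ℕ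
μ-sum a zero = 0
μ-sum a (suc l) = μ a + μ-sum (suc a) l

L∞-suc : ∀ n → L∞ (suc (suc n)) ≡ L∞ (suc n) + μ (suc n)
L∞-suc n = begin
  sum (map (μ ∘ suc) (upTo (suc n)))               ≡⟨ cong (sum ∘ map (μ ∘ suc)) (upTo-∷ʳ n) ⟨
  sum (map (μ ∘ suc) (upTo n ∷ʳ n))                ≡⟨ cong sum (map-++ (μ ∘ suc) (upTo n) (n ∷ [])) ⟩
  sum (map (μ ∘ suc) (upTo n) ∷ʳ μ (suc n))        ≡⟨ sum-++ (map (μ ∘ suc) (upTo n)) (μ (suc n) ∷ []) ⟩
  L∞ (suc n) + (μ (suc n) + 0)                     ≡⟨ cong (L∞ (suc n) +_) (+-identityʳ (μ (suc n))) ⟩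
  L∞ (suc n) + μ (suc n)                           ∎
  where open ≡-Reasoning

L∞-+ : ∀ a l → L∞ (suc a + l) ≡ L∞ (suc a) + μ-sum (suc a) l
L∞-+ a zero = trans (cong L∞ (+-identityʳ (suc a))) (sym (+-identityʳ (L∞ (suc a))))
L∞-+ a (suc l) = begin
  L∞ (suc a + suc l)                                ≡⟨ cong L∞ (+-suc (suc a) l) ⟩
  L∞ (suc (suc a) + l)                              ≡⟨ L∞-+ (suc a) l ⟩
  L∞ (suc (suc a)) + μ-sum (suc (suc a)) l          ≡⟨ cong (_+ μ-sum (suc (suc a)) l) (L∞-suc a) ⟩
  L∞ (suc a) + μ (suc a) + μ-sum (suc (suc a)) l    ≡⟨ +-assoc (L∞ (suc a)) (μ (suc a)) _ ⟩
  L∞ (suc a) + μ-sum (suc a) (suc l)                ∎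
  where open ≡-Reasoning

L∞-∸ : ∀ {a} l → 1 ≤ a → L∞ (a + l) ∸ L∞ a ≡ μ-sum a l
L∞-∸ {suc a} l _ = trans (cong (_∸ L∞ (suc a)) (L∞-+ a l)) (m+n∸m≡n (L∞ (suc a)) _)

D¹≡μ-sum : ∀ k {l} → p (suc k) ≡ p k + l → D¹ k ≡ μ-sum (p k) l
D¹≡μ-sum k {l} gap = trans (cong (λ n → L∞ n ∸ L∞ (p k)) gap) (L∞-∸ l (p≥1 k))

μ-sum-+ : ∀ a l m → μ-sum a (l + m) ≡ μ-sum a l + μ-sum (l + a) m
μ-sum-+ a zero m = refl
μ-sum-+ a (suc l) m = begin
  μ a + μ-sum (suc a) (l + m)                     ≡⟨ cong (μ a +_) (μ-sum-+ (suc a) l m) ⟩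
  μ a + (μ-sum (suc a) l + μ-sum (l + suc a) m)   ≡⟨ +-assoc (μ a) _ _ ⟨
  μ-sum a (suc l) + μ-sum (l + suc a) m           ≡⟨ cong (λ b → μ-sum a (suc l) + μ-sum b m) (+-suc l a) ⟩
  μ-sum a (suc l) + μ-sum (suc l + a) m           ∎
  where open ≡-Reasoning

μ-sum-mono : ∀ a {l m} → l ≤ m → μ-sum a l ≤ μ-sum a m
μ-sum-mono a {l} l≤m with o , l+o≡m ← m≤n⇒∃[o]m+o≡n l≤m =
  subst (λ m → μ-sum a l ≤ μ-sum a m) l+o≡m (≤-trans (m≤m+n _ _) (≤-reflexive (sym (μ-sum-+ a l o))))

maxExp≤μ-sum : ∀ {a K} l → a ≤ K → K < a + l → maxExp K ≤ μ-sum a l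
maxExp≤μ-sum {a} {K} zero a≤K K<a+0 = contradiction a≤K (<⇒≱ (subst (K <_) (+-identityʳ a) K<a+0))
maxExp≤μ-sum {a} {K} (suc l) a≤K K<a+l with m≤n⇒m<n∨m≡n a≤K
... | inj₂ refl = ≤-trans (m≤n⊔m (maxExp (suc a)) (maxExp a)) (m≤m+n (μ a) _)
... | inj₁ a<K = ≤-trans (maxExp≤μ-sum l a<K (subst (K <_) (+-suc a l) K<a+l)) (m≤n+m _ (μ a))

maxExp≤D¹ : ∀ k {K} → p k ≤ K → K < p (suc k) → maxExp K ≤ D¹ k
maxExp≤D¹ k {K} pk≤K K<p[k+1] with l , gap ← m≤n⇒∃[o]m+o≡n (<⇒≤ (p<p-suc k)) =
  subst (maxExp K ≤_) (sym (D¹≡μ-sum k (sym gap))) (maxExp≤μ-sum l pk≤K (subst (K <_) (sym gap) K<p[k+1]))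

D¹-unbounded : ∀ B → ∃[ k ] (1 ≤ k × B ≤ D¹ k)
D¹-unbounded B
  with k , 1≤k , pk≤N , N<p[k+1]
         ← ∃-primeGap∋ (≤-trans (s≤s (s≤s z≤n)) (n<d^n (s≤s (s≤s z≤n)) (suc B))) =
  k , 1≤k , (begin
    B                    ≤⟨ n≤1+n B ⟩
    suc B                ≤⟨ ^∣⇒≤maxExp {{m^n≢0 2 (suc B)}} prime[2] ∣-refl ⟩
    maxExp (2 ^ suc B)   ≤⟨ maxExp≤D¹ k pk≤N N<p[k+1] ⟩
    D¹ k                 ∎)
  where open ≤-Reasoning

even⊎odd : ∀ n → ∃[ t ] (n ≡ 2 * t ⊎ n ≡ suc (2 * t))
even⊎odd zero = 0 , inj₁ refl
even⊎odd (suc n) with even⊎odd n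
... | t , inj₁ refl = t , inj₂ refl
... | t , inj₂ refl = suc t , inj₁ (cong suc (sym (+-suc t (t + 0))))

prime≥3⇒odd : ∀ {q} → Prime q → 3 ≤ q → ∃[ u ] q ≡ suc (2 * u)
prime≥3⇒odd {q} pq 3≤q with even⊎odd q
... | u , inj₂ q≡2u+1 = u , q≡2u+1
... | u , inj₁ q≡2u with prime⇒irreducible pq (divides u (trans q≡2u (*-comm 2 u)))
...   | inj₁ ()
...   | inj₂ 2≡q = contradiction 3≤q (<-irrefl 2≡q)

odd<odd⇒even-gap : ∀ u v → suc (2 * u) < suc (2 * v) → ∃[ w ] suc (2 * v) ≡ suc (2 * u) + 2 * suc w
odd<odd⇒even-gap u v 2u+1<2v+1
  with w , u+1+w≡v ← m≤n⇒∃[o]m+o≡n (*-cancelˡ-< 2 u v (≤-pred 2u+1<2v+1)) =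
  w , (begin
    suc (2 * v)              ≡⟨ cong (suc ∘ (2 *_)) (trans (+-suc u w) u+1+w≡v) ⟨
    suc (2 * (u + suc w))    ≡⟨ cong suc (*-distribˡ-+ 2 u (suc w)) ⟩
    suc (2 * u) + 2 * suc w  ∎)
  where open ≡-Reasoning

primeGap-even : ∀ k → 2 ≤ k → ∃[ u ] ∃[ w ] (p k ≡ suc (2 * u) × p (suc k) ≡ p k + 2 * suc w)
primeGap-even k 2≤k
  with u , pk≡ ← prime≥3⇒odd (p-prime (≤-trans (s≤s z≤n) 2≤k)) (≤-trans (s≤s 2≤k) (k<p k))
  with v , p[k+1]≡ ← prime≥3⇒odd (p-prime {suc k} (s≤s z≤n))
                                  (≤-trans (s≤s 2≤k) (<⇒≤ (k<p (suc k))))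
  with w , gap ← odd<odd⇒even-gap u v (subst₂ _<_ pk≡ p[k+1]≡ (p<p-suc k)) =
  u , w , pk≡ , trans p[k+1]≡ (trans gap (cong (_+ 2 * suc w) (sym pk≡)))

μ-sum-2 : ∀ a {c} → c ≤ maxExp (suc a) → 2 * c ≤ μ-sum a 2
μ-sum-2 a h =
  +-mono-≤ (≤-trans h (m≤m⊔n (maxExp (suc a)) (maxExp a)))
           (+-mono-≤ (≤-trans h (m≤n⊔m (maxExp (2 + a)) (maxExp (suc a)))) z≤n)

μ-sum-twin : ∀ {a} → 1 ≤ a → maxExp a ≤ 1 → maxExp (2 + a) ≤ 1 → μ-sum a 2 ≡ 2 * maxExp (suc a)
μ-sum-twin {a} 1≤a h₀ h₂ =
  cong₂ _+_ (m≥n⇒m⊔n≡m (≤-trans h₀ 1≤m)) (cong (_+ 0) (m≤n⇒m⊔n≡n (≤-trans h₂ 1≤m)))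
  where
  1≤m : 1 ≤ maxExp (suc a)
  1≤m = 1≤maxExp (s≤s 1≤a)

4∣4+2[2t] : ∀ t → 4 ∣ 4 + 2 * (2 * t)
4∣4+2[2t] t = ∣m∣n⇒∣m+n ∣-refl (divides t (trans (sym (*-assoc 2 2 t)) (*-comm 4 t)))

4∣2+2u⊎4∣4+2u : ∀ u → 4 ∣ 2 + 2 * u ⊎ 4 ∣ 4 + 2 * u
4∣2+2u⊎4∣4+2u u with even⊎odd u
... | t , inj₁ refl = inj₂ (4∣4+2[2t] t)
... | t , inj₂ refl = inj₁ (subst (4 ∣_) (sym (cong (2 +_) (*-distribˡ-+ 2 1 (2 * t)))) (4∣4+2[2t] t))

6≤μ-sum-odd : ∀ u → 6 ≤ μ-sum (suc (2 * u)) 4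
6≤μ-sum-odd u = subst (6 ≤_) (sym (μ-sum-+ a 2 2)) (two-pairs (4∣2+2u⊎4∣4+2u u))
  where
  a : ℕ
  a = suc (2 * u)
  two-pairs : 4 ∣ suc a ⊎ 4 ∣ 3 + a → 6 ≤ μ-sum a 2 + μ-sum (2 + a) 2
  two-pairs (inj₁ 4∣) = +-mono-≤ (μ-sum-2 a (^∣⇒≤maxExp {e = 2} prime[2] 4∣))
                                 (μ-sum-2 (2 + a) (1≤maxExp {3 + a} (s≤s (s≤s z≤n))))
  two-pairs (inj₂ 4∣) = +-mono-≤ (μ-sum-2 a (1≤maxExp {suc a} (s≤s (s≤s z≤n))))
                                 (μ-sum-2 (2 + a) (^∣⇒≤maxExp {e = 2} prime[2] 4∣))

D¹-even⊎≥6 : ∀ k → 2 ≤ k → (∃[ x ] D¹ k ≡ 2 * x) ⊎ 6 ≤ D¹ k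
D¹-even⊎≥6 k 2≤k with primeGap-even k 2≤k
... | _ , zero , _ , gap =
  inj₁ (maxExp (suc (p k)) , trans (D¹≡μ-sum k gap) (μ-sum-twin (p≥1 k) maxExp[pk]≤1 maxExp[2+pk]≤1))
  where
  maxExp[pk]≤1 : maxExp (p k) ≤ 1
  maxExp[pk]≤1 = maxExp≤1 (p-prime (≤-trans (s≤s z≤n) 2≤k))
  maxExp[2+pk]≤1 : maxExp (2 + p k) ≤ 1
  maxExp[2+pk]≤1 =
    subst (λ n → maxExp n ≤ 1) (trans gap (+-comm (p k) 2)) (maxExp≤1 (p-prime {suc k} (s≤s z≤n)))
... | u , suc w , pk≡ , gap = inj₂ (begin
  6                               ≤⟨ 6≤μ-sum-odd u ⟩
  μ-sum (suc (2 * u)) 4           ≡⟨ cong (λ a → μ-sum a 4) pk≡ ⟨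
  μ-sum (p k) 4                   ≤⟨ μ-sum-mono (p k) (*-monoʳ-≤ 2 {2} {suc (suc w)} (s≤s (s≤s z≤n))) ⟩
  μ-sum (p k) (2 * suc (suc w))   ≡⟨ D¹≡μ-sum k gap ⟨
  D¹ k                            ∎)
  where open ≤-Reasoning

≢3∧≢5 : ∀ {n} → (∃[ x ] n ≡ 2 * x) ⊎ 6 ≤ n → (n ≢ 3) × (n ≢ 5)
≢3∧≢5 (inj₁ (x , refl)) = even≢odd x 1 , even≢odd x 2
≢3∧≢5 (inj₂ 6≤n) = (λ { refl → from-no (6 ≤? 3) 6≤n }) , (λ { refl → from-no (6 ≤? 5) 6≤n })

D¹≢3∧≢5 : ∀ k → 1 ≤ k → (D¹ k ≢ 3) × (D¹ k ≢ 5)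
-- D¹ 1 = L∞ 3 ∸ L∞ 2 evaluates to 1.
D¹≢3∧≢5 1 _ = (λ ()) , (λ ())
D¹≢3∧≢5 (2+ k) _ = ≢3∧≢5 (D¹-even⊎≥6 (2+ k) (s≤s (s≤s z≤n)))

claim3p1 : ((B : ℕ) → ∃[ k ] (1 ≤ k × B ≤ D¹ k))
           × ((k : ℕ) → 1 ≤ k → (D¹ k ≢ 3) × (D¹ k ≢ 5))
claim3p1 = D¹-unbounded , D¹≢3∧≢5
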